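{- Let $s \ge 2$ be an integer. Suppose that for every integer $m \ge 1$, every $(s+1)$-saturated family of subsets of $[m]$ has size at least $(1 - 2^{ -s})\,2^m$. Then for every integer $n \ge 1$, every $s$-saturated family of subsets of $[n]$ has size at least $(1 - 2^{ -(s-1)})\,2^n$.
   Context: $[n] = \{1,\ldots,n\}$. For an integer $t \ge 2$, a family $\mathcal{F}$ of subsets of $[n]$ is called $t$-saturated if $\mathcal{F}$ contains no $t$ pairwise disjoint sets, and moreover $\mathcal{F}$ is maximal with respect to this property: for every subset $A \subseteq [n]$ with $A \notin \mathcal{F}$, the family $\mathcal{F} \cup \{A\}$ contains $t$ pairwise disjoint sets. -}

module Defs where

open import Data.Nat using (ℕ; _+_; _*_; _∸_; _^_; _≥_)
open import Data.Fin using (Fin)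
open import Data.Fin.Subset using (Subset; _∩_; ⊥)
open import Data.List using (List; length)
open import Data.List.Membership.Propositional using (_∈_; _∉_)
open import Data.List.Relation.Unary.Unique.Propositional using (Unique)
open import Data.Product using (Σ; _×_; ∃)
open import Relation.Binary.PropositionalEquality using (_≡_; _≢_)
open import Relation.Nullary using (¬_)

-- A finite family of subsets of [n], represented as a duplicate-free list
-- of subsets (Subset n = characteristic vectors over Fin n).
Family : ℕ → Set
Family n = List (Subset n)

Disjoint : ∀ {n} → Subset n → Subset n → Set
Disjoint A B = A ∩ B ≡ ⊥

HasDisjoint : ∀ {n} → ℕ → List (Subset n) → Set
HasDisjoint {n} t L =
  Σ (Fin t → Subset n) λ f →
    (∀ i → f i ∈ L) ×
    (∀ i j → i ≢ j → f i ≢ f j) ×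
    (∀ i j → i ≢ j → Disjoint (f i) (f j))

Saturated : ∀ {n} → ℕ → Family n → Set
Saturated {n} t F =
  Unique F ×
  ¬ HasDisjoint t F ×
  (∀ (A : Subset n) → A ∉ F → HasDisjoint t (A Data.List.∷ F))

-- Given an s-saturated family F on [n], form the family on [n+1] consisting of
-- F (on sets avoiding the new point 0) together with all 2^n sets containing 0.
-- It is (s+1)-saturated: pairwise disjoint sets contain 0 at most once, and a
-- missing set avoiding 0 completes s-1 disjoint members of F together with {0}.
-- It has 2^n + |F| members, so the bound for s+1 on [n+1] gives
-- (1 - 2^-s) 2^(n+1) ≤ 2^n + |F|, which is the claimed bound for s on [n].
module Submission where

open import Defs
open import Data.Bool using (_≟_)
open import Data.Bool.Properties using (∧-identityʳ; ¬-not)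
open import Data.Empty using (⊥-elim)
open import Data.Fin using (Fin; punchIn) renaming (zero to fzero; suc to fsuc)
open import Data.Fin.Properties using (any?; punchIn-injective; punchInᵢ≢i)
open import Data.Fin.Subset using (Subset; _∩_; ⊥; inside; outside)
open import Data.Fin.Subset.Properties using (∩-zeroˡ; ∩-zeroʳ)
open import Data.List using (List; []; _∷_; length; map; _++_)
open import Data.List.Membership.Propositional using (_∈_; _∉_)
open import Data.List.Membership.Propositional.Properties
  using (∈-map⁺; ∈-map⁻; ∈-++⁺ˡ; ∈-++⁺ʳ; ∈-++⁻)
open import Data.List.Properties using (length-++; length-map)
open import Data.List.Relation.Unary.Any using (here; there)
import Data.List.Relation.Unary.All as All
import Data.List.Relation.Unary.AllPairs as AllPairs
open import Data.List.Relation.Unary.Unique.Propositional using (Unique)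
import Data.List.Relation.Unary.Unique.Propositional.Properties as Unique
open import Data.Nat using (ℕ; zero; suc; _+_; _*_; _∸_; _^_; _≥_; _≤_; s≤s; z≤n)
open import Data.Nat.Properties using (+-comm; +-identityʳ; *-cancelˡ-≤; +-cancelˡ-≤; m^n>0)
open import Data.Nat.Tactic.RingSolver using (solve-∀)
open import Data.Product using (∃; _×_; _,_)
open import Data.Sum using (inj₁; inj₂)
open import Data.Vec using (head; tail)
  renaming (_∷_ to _∷ᵥ_; [] to []ᵥ)
open import Data.Vec.Properties using (∷-injectiveˡ; ∷-injectiveʳ)
open import Function using (_∘_)
open import Relation.Nullary using (¬_; yes; no)
open import Relation.Binary.PropositionalEquality
  using (_≡_; _≢_; refl; sym; trans; cong; subst; subst₂)

allSubsets : ∀ n → List (Subset n)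
allSubsets zero    = []ᵥ ∷ []
allSubsets (suc n) = map (inside ∷ᵥ_) (allSubsets n) ++ map (outside ∷ᵥ_) (allSubsets n)

∈-allSubsets : ∀ {n} (A : Subset n) → A ∈ allSubsets n
∈-allSubsets []ᵥ = here refl
∈-allSubsets (inside ∷ᵥ A) = ∈-++⁺ˡ (∈-map⁺ _ (∈-allSubsets A))
∈-allSubsets {suc n} (outside ∷ᵥ A) =
  ∈-++⁺ʳ (map (inside ∷ᵥ_) (allSubsets n)) (∈-map⁺ _ (∈-allSubsets A))

inside∷≢outside∷ : ∀ {n} (X Y : List (Subset n)) {A} →
  ¬ (A ∈ map (inside ∷ᵥ_) X × A ∈ map (outside ∷ᵥ_) Y)
inside∷≢outside∷ X Y (p , q) with ∈-map⁻ _ p | ∈-map⁻ _ q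
... | _ , _ , refl | _ , _ , ()

allSubsets-unique : ∀ n → Unique (allSubsets n)
allSubsets-unique zero = All.[] AllPairs.∷ AllPairs.[]
allSubsets-unique (suc n) =
  Unique.++⁺ (Unique.map⁺ ∷-injectiveʳ (allSubsets-unique n))
             (Unique.map⁺ ∷-injectiveʳ (allSubsets-unique n))
             (inside∷≢outside∷ (allSubsets n) (allSubsets n))

length-allSubsets : ∀ n → length (allSubsets n) ≡ 2 ^ n
length-allSubsets zero = refl
length-allSubsets (suc n)
  rewrite length-++ (map (inside ∷ᵥ_) (allSubsets n)) {map (outside ∷ᵥ_) (allSubsets n)}
        | length-map (inside ∷ᵥ_) (allSubsets n) | length-map (outside ∷ᵥ_) (allSubsets n)
        | length-allSubsets n | +-identityʳ (2 ^ n) = refl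

extend : ∀ {n} → Family n → Family (suc n)
extend {n} F = map (inside ∷ᵥ_) (allSubsets n) ++ map (outside ∷ᵥ_) F

module _ {n} {F : Family n} where

  inside∷-∈-extend : ∀ A → inside ∷ᵥ A ∈ extend F
  inside∷-∈-extend A = ∈-++⁺ˡ (∈-map⁺ _ (∈-allSubsets A))

  outside∷-∈-extend : ∀ {A} → A ∈ F → outside ∷ᵥ A ∈ extend F
  outside∷-∈-extend A∈F = ∈-++⁺ʳ (map (inside ∷ᵥ_) (allSubsets n)) (∈-map⁺ _ A∈F)

  outside∷-∈-extend⁻ : ∀ {A} → outside ∷ᵥ A ∈ extend F → A ∈ F
  outside∷-∈-extend⁻ p with ∈-++⁻ (map (inside ∷ᵥ_) (allSubsets n)) p
  ... | inj₁ q with ∈-map⁻ _ q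
  ...   | _ , _ , ()
  outside∷-∈-extend⁻ p | inj₂ q with ∈-map⁻ _ q
  ...   | _ , B∈F , refl = B∈F

  extend-unique : Unique F → Unique (extend F)
  extend-unique uF = Unique.++⁺ (Unique.map⁺ ∷-injectiveʳ (allSubsets-unique n))
                                (Unique.map⁺ ∷-injectiveʳ uF)
                                (inside∷≢outside∷ (allSubsets n) F)

  length-extend : length (extend F) ≡ 2 ^ n + length F
  length-extend
    rewrite length-++ (map (inside ∷ᵥ_) (allSubsets n)) {map (outside ∷ᵥ_) F}
          | length-map (inside ∷ᵥ_) (allSubsets n) | length-map (outside ∷ᵥ_) F
          | length-allSubsets n = refl

Disjoint-inside⇒outside : ∀ {n} (A B : Subset (suc n)) →
  head B ≡ inside → Disjoint A B → head A ≡ outside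
Disjoint-inside⇒outside (x ∷ᵥ _) (_ ∷ᵥ _) refl A∩B≡⊥ =
  trans (sym (∧-identityʳ x)) (∷-injectiveˡ A∩B≡⊥)

head≡outside⇒≡outside∷tail : ∀ {n} (A : Subset (suc n)) → head A ≡ outside → A ≡ outside ∷ᵥ tail A
head≡outside⇒≡outside∷tail (_ ∷ᵥ _) refl = refl

all-but-one-outside : ∀ {t n} (f : Fin (suc t) → Subset (suc n)) →
  (∀ i j → i ≢ j → Disjoint (f i) (f j)) →
  ∃ λ i₀ → ∀ k → k ≢ i₀ → head (f k) ≡ outside
all-but-one-outside f disjoint with any? (λ i → head (f i) ≟ inside)
... | yes (i₀ , fi₀∋0) = i₀ , λ k k≢i₀ → Disjoint-inside⇒outside (f k) (f i₀) fi₀∋0 (disjoint k i₀ k≢i₀)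
... | no ∄i = fzero , λ k _ → ¬-not (λ fk∋0 → ∄i (k , fk∋0))

HasDisjoint-extend⇒HasDisjoint : ∀ t {n} {F : Family n} →
  HasDisjoint (suc t) (extend F) → HasDisjoint t F
HasDisjoint-extend⇒HasDisjoint t {F = F} (f , f∈ , distinct , disjoint)
  with all-but-one-outside f disjoint
... | i₀ , others-outside = g , g∈F , g-distinct , g-disjoint
  where
  skip : Fin t → Fin (suc t)
  skip = punchIn i₀

  skip-≢ : ∀ {i j} → i ≢ j → skip i ≢ skip j
  skip-≢ i≢j = λ eq → i≢j (punchIn-injective i₀ _ _ eq)

  g : Fin t → Subset _
  g j = tail (f (skip j))

  f≡outside∷g : ∀ j → f (skip j) ≡ outside ∷ᵥ g j
  f≡outside∷g j = head≡outside⇒≡outside∷tail (f (skip j)) (others-outside (skip j) (punchInᵢ≢i i₀ j))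

  g∈F : ∀ j → g j ∈ F
  g∈F j = outside∷-∈-extend⁻ (subst (_∈ extend F) (f≡outside∷g j) (f∈ (skip j)))

  g-distinct : ∀ i j → i ≢ j → g i ≢ g j
  g-distinct i j i≢j gi≡gj = distinct (skip i) (skip j) (skip-≢ i≢j)
    (trans (f≡outside∷g i) (trans (cong (outside ∷ᵥ_) gi≡gj) (sym (f≡outside∷g j))))

  g-disjoint : ∀ i j → i ≢ j → Disjoint (g i) (g j)
  g-disjoint i j i≢j = ∷-injectiveʳ
    (subst₂ Disjoint (f≡outside∷g i) (f≡outside∷g j) (disjoint (skip i) (skip j) (skip-≢ i≢j)))

HasDisjoint-∷-extend : ∀ t {n} {F : Family n} {A} →
  HasDisjoint t (A ∷ F) → HasDisjoint (suc t) ((outside ∷ᵥ A) ∷ extend F)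
HasDisjoint-∷-extend t {n} {F} {A} (f , f∈ , distinct , disjoint) = h , h∈ , h-distinct , h-disjoint
  where
  h : Fin (suc t) → Subset (suc n)
  h fzero    = inside ∷ᵥ ⊥
  h (fsuc j) = outside ∷ᵥ f j

  h∈ : ∀ i → h i ∈ (outside ∷ᵥ A) ∷ extend F
  h∈ fzero = there (inside∷-∈-extend ⊥)
  h∈ (fsuc j) with f∈ j
  ... | here fj≡A  = here (cong (outside ∷ᵥ_) fj≡A)
  ... | there fj∈F = there (outside∷-∈-extend fj∈F)

  h-distinct : ∀ i j → i ≢ j → h i ≢ h j
  h-distinct fzero    fzero    i≢j _ = i≢j refl
  h-distinct (fsuc i) (fsuc j) i≢j eq = distinct i j (λ i≡j → i≢j (cong fsuc i≡j)) (∷-injectiveʳ eq)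
  h-distinct fzero    (fsuc j) _ ()
  h-distinct (fsuc i) fzero    _ ()

  h-disjoint : ∀ i j → i ≢ j → Disjoint (h i) (h j)
  h-disjoint fzero    fzero    i≢j = ⊥-elim (i≢j refl)
  h-disjoint fzero    (fsuc j) _   = cong (outside ∷ᵥ_) (∩-zeroˡ (f j))
  h-disjoint (fsuc i) fzero    _   = cong (outside ∷ᵥ_) (∩-zeroʳ (f i))
  h-disjoint (fsuc i) (fsuc j) i≢j = cong (outside ∷ᵥ_) (disjoint i j (λ i≡j → i≢j (cong fsuc i≡j)))

Saturated-extend : ∀ t {n} {F : Family n} → Saturated t F → Saturated (suc t) (extend F)
Saturated-extend t {F = F} (unique , ¬disjoint , maximal) =
  extend-unique unique , ¬disjoint ∘ HasDisjoint-extend⇒HasDisjoint t , extend-maximal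
  where
  extend-maximal : ∀ A → A ∉ extend F → HasDisjoint (suc t) (A ∷ extend F)
  extend-maximal (inside ∷ᵥ A) A∉ = ⊥-elim (A∉ (inside∷-∈-extend A))
  extend-maximal (outside ∷ᵥ A) A∉ =
    HasDisjoint-∷-extend t (maximal A (A∉ ∘ outside∷-∈-extend))

-- The bound for s+1 on [n+1] read with a = 2^(s-1), N = 2^n and |extend F| = N + L.
extension-bound⇒bound : ∀ {a} N L → 1 ≤ a →
  (2 * a ∸ 1) * (2 * N) ≤ (N + L) * (2 * a) → (a ∸ 1) * N ≤ L * a
extension-bound⇒bound {suc p} N L (s≤s z≤n) bound =
  +-cancelˡ-≤ (N * suc p) _ _ (*-cancelˡ-≤ 2 (subst₂ _≤_ lhs (expand-rhs p N L) bound))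
  where
  expand-lhs : ∀ p N → (p + suc p) * (2 * N) ≡ 2 * (N * suc p + p * N)
  expand-lhs = solve-∀

  lhs : (2 * suc p ∸ 1) * (2 * N) ≡ 2 * (N * suc p + p * N)
  lhs = trans (cong (λ x → (p + x) * (2 * N)) (+-identityʳ (suc p))) (expand-lhs p N)

  expand-rhs : ∀ p N L → (N + L) * (2 * suc p) ≡ 2 * (N * suc p + L * suc p)
  expand-rhs = solve-∀

proposition3p2 : (s : ℕ) → s ≥ 2 →
    (∀ (m : ℕ) → m ≥ 1 → (F : Family m) → Saturated (s + 1) F →
      (2 ^ s ∸ 1) * 2 ^ m ≤ length F * 2 ^ s) →
    ∀ (n : ℕ) → n ≥ 1 → (F : Family n) → Saturated s F →
      (2 ^ (s ∸ 1) ∸ 1) * 2 ^ n ≤ length F * 2 ^ (s ∸ 1)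
proposition3p2 (suc t) (s≤s _) hypothesis n _ F saturated =
  extension-bound⇒bound (2 ^ n) (length F) (m^n>0 2 t) extension-bound
  where
  extend-saturated : Saturated (suc t + 1) (extend F)
  extend-saturated =
    subst (λ r → Saturated r (extend F)) (+-comm 1 (suc t)) (Saturated-extend (suc t) saturated)

  extension-bound : (2 ^ suc t ∸ 1) * 2 ^ suc n ≤ (2 ^ n + length F) * 2 ^ suc t
  extension-bound = subst (λ L → (2 ^ suc t ∸ 1) * 2 ^ suc n ≤ L * 2 ^ suc t) (length-extend {F = F})
    (hypothesis (suc n) (s≤s z≤n) (extend F) extend-saturated)
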